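{- Let $k,n,s$ be positive integers and let $x_1,\dots,x_n$ be independent variables. Then \[ M_{k}^{(s)}(x_{1},\ldots,x_{n})=\sum_{j=0}^{\lfloor k/(s+1) \rfloor} h_{j}(x_{1}^{s+1},\ldots,x_{n}^{s+1})\,e_{k-(s+1)j}(x_{1},\ldots,x_{n}). \]
   Context: $M_{k}^{(s)}(x_{1},\ldots,x_{n})=\sum x_{1}^{a_{1}}\cdots x_{n}^{a_{n}}$, the sum over all $n$-tuples of nonnegative integers with $a_1+\cdots+a_n=k$ and each $a_i\equiv 0$ or $1 \pmod{s+1}$. $h_j$ and $e_j$ denote the complete homogeneous and elementary symmetric polynomials of degree $j$ (with $h_0=e_0=1$ and $e_j=0$ for $j>n$). -}

module Defs where

open import Level using (Level)
open import Data.Nat using (ℕ; zero; suc; _∸_; _≡ᵇ_; _≤ᵇ_)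
open import Data.Nat.DivMod using (_%_)
open import Data.Bool using (Bool; true; false; _∨_; _∧_)
open import Data.List using (List; []; _∷_; [_]; map; concatMap; upTo; filter; foldr)
open import Data.Vec using (Vec; []; _∷_)
open import Algebra.Bundles using (CommutativeRing)
open import Relation.Nullary.Decidable using (Dec; yes; no)
open import Relation.Binary.PropositionalEquality using (_≡_; refl)
open import Data.Bool.Properties using (_≟_)

tuples : (n k : ℕ) → List (Vec ℕ n)
tuples zero zero = [] ∷ []
tuples zero (suc k) = []
tuples (suc n) k = concatMap (λ a → map (a ∷_) (tuples n (k ∸ a))) (upTo (suc k))

allᵇ : {n : ℕ} → (ℕ → Bool) → Vec ℕ n → Bool
allᵇ p [] = true
allᵇ p (a ∷ as) = p a ∧ allᵇ p as

congOK : (s a : ℕ) → Bool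
congOK s a = ((a % suc s) ≡ᵇ 0) ∨ ((a % suc s) ≡ᵇ 1)

zeroOne : ℕ → Bool
zeroOne a = a ≤ᵇ 1

module _ {c ℓ : Level} (R : CommutativeRing c ℓ) where
  open CommutativeRing R

  pow : Carrier → ℕ → Carrier
  pow x zero = 1#
  pow x (suc m) = x * pow x m

  Σ-list : {A : Set} → (A → Carrier) → List A → Carrier
  Σ-list f = foldr (λ a acc → f a + acc) 0#

  Σ-upto : ℕ → (ℕ → Carrier) → Carrier
  Σ-upto m f = Σ-list f (upTo (suc m))

  monomial : {n : ℕ} → Vec Carrier n → Vec ℕ n → Carrier
  monomial [] [] = 1#
  monomial (x ∷ xs) (a ∷ as) = pow x a * monomial xs as

  restrictedSum : {n : ℕ} → (ℕ → Bool) → ℕ → Vec Carrier n → Carrier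
  restrictedSum {n} p k xs = Σ-list (monomial xs) (filter (λ a → allᵇ p a ≟ true) (tuples n k))

  M : {n : ℕ} → (k s : ℕ) → Vec Carrier n → Carrier
  M k s xs = restrictedSum (congOK s) k xs

  h : {n : ℕ} → ℕ → Vec Carrier n → Carrier
  h j xs = restrictedSum (λ _ → true) j xs

  -- elementary symmetric polynomial e_j (square-free monomials of degree j; 0 if j > n)
  e : {n : ℕ} → ℕ → Vec Carrier n → Carrier
  e j xs = restrictedSum zeroOne j xs

  powVec : {n : ℕ} → ℕ → Vec Carrier n → Vec Carrier n
  powVec m [] = []
  powVec m (x ∷ xs) = pow x m ∷ powVec m xs

-- Since the exponent of each variable is restricted independently, the generating
-- function of the restricted sums is a product over the variables:
--   Σ_k M_k t^k = Π_i (1 + x_i t) / (1 − x_i^{s+1} t^{s+1})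
--               = (Σ_m e_m t^m) · (Σ_j h_j(x^{s+1}) t^{(s+1) j}),
-- since for s ≥ 1 the exponents a ≡ 0, 1 (mod s+1) are exactly the sums of a ∈ {0,1}
-- and a multiple of s+1, each in one way.  Comparing coefficients of t^k gives the
-- theorem.  The substitution t ↦ t^{s+1} is the dilation of series, which is
-- multiplicative.
module Submission where

open import Defs
open import Level using (Level)
open import Algebra.Bundles using (CommutativeRing; CommutativeSemigroup)
open import Algebra.Structures using (IsCommutativeSemigroup)
import Algebra.Properties.CommutativeSemigroup as CommutativeSemigroupProperties
open import Agda.Builtin.Nat using (div-helper)
open import Data.Bool using (Bool; true; false; if_then_else_; _∨_)
open import Data.Bool.Properties using (_≟_)
open import Data.List using (List; []; _∷_; map; concatMap; upTo; applyUpTo; filter; _++_)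
open import Data.List.Properties using (filter-++)
open import Data.Nat using (ℕ; zero; suc; _+_; _*_; _∸_; _≤_; _<_; s≤s⁻¹; z≤n; s≤s; NonZero; _≡ᵇ_)
open import Data.Nat.DivMod
  using (_/_; _%_; m≡m%n+[m/n]*n; m%n<n; %-pred-≡0; m<[1+n%d]⇒m≤[n%d]; [1+m%d]≤1+n⇒[m%d]≤n)
open import Data.Nat.DivMod.Core using (divₕ-extractAcc)
import Data.Nat.Properties as ℕ
open import Data.Vec using (Vec; []; _∷_)
open import Data.Product using (_×_; _,_)
open import Data.Sum using (_⊎_; inj₁; inj₂)
open import Relation.Nullary.Decidable using (Dec; yes; no)
open import Relation.Binary.PropositionalEquality as ≡ using (_≡_)

suc-%-cases : ∀ a d .{{_ : NonZero d}} → suc a % d ≡ suc (a % d) ⊎ (suc a % d ≡ 0 × a % d ≡ d ∸ 1)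
suc-%-cases a d with suc a % d in eq
... | zero  = inj₂ (≡.refl , %-pred-≡0 eq)
... | suc r = inj₁ (≡.cong suc (ℕ.≤-antisym r≤a%d a%d≤r))
  where
  r≤a%d : r ≤ a % d
  r≤a%d = m<[1+n%d]⇒m≤[n%d] a d (ℕ.≤-reflexive (≡.sym eq))

  a%d≤r : a % d ≤ r
  a%d≤r = [1+m%d]≤1+n⇒[m%d]≤n a r d (ℕ.≤-trans (s≤s z≤n) (ℕ.≤-reflexive (≡.sym eq))) (ℕ.≤-reflexive eq)

module PowerSeries {c ℓ : Level} (R : CommutativeRing c ℓ) where
  open CommutativeRing R renaming (_+_ to _⊕_; _*_ to _⊗_)
  open import Relation.Binary.Reasoning.Setoid setoid

  0⊗x⊕y≈y : ∀ x y → 0# ⊗ x ⊕ y ≈ y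
  0⊗x⊕y≈y x y = trans (+-congʳ (zeroˡ x)) (+-identityˡ y)

  pow-+ : ∀ x m n → pow R x (m + n) ≈ pow R x m ⊗ pow R x n
  pow-+ x zero    n = sym (*-identityˡ _)
  pow-+ x (suc m) n = trans (*-congˡ (pow-+ x m n)) (sym (*-assoc _ _ _))

  pow-pow : ∀ x m i → pow R (pow R x m) i ≈ pow R x (i * m)
  pow-pow x m zero    = refl
  pow-pow x m (suc i) = trans (*-congˡ (pow-pow x m i)) (sym (pow-+ x m (i * m)))

  Σ-list-++ : ∀ {A : Set} (f : A → Carrier) xs ys → Σ-list R f (xs ++ ys) ≈ Σ-list R f xs ⊕ Σ-list R f ys
  Σ-list-++ f []       ys = sym (+-identityˡ _)
  Σ-list-++ f (x ∷ xs) ys = trans (+-congˡ (Σ-list-++ f xs ys)) (sym (+-assoc _ _ _))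

  Series : Set c
  Series = ℕ → Carrier

  infix 4 _≋_
  _≋_ : Series → Series → Set ℓ
  f ≋ g = ∀ n → f n ≈ g n

  tail : Series → Series
  tail f n = f (suc n)

  𝟙 : Series
  𝟙 zero    = 1#
  𝟙 (suc n) = 0#

  sum : ℕ → Series → Carrier
  sum zero    f = 0#
  sum (suc n) f = f 0 ⊕ sum n (tail f)

  Σ-list-applyUpTo : ∀ n (f : Series) (g : ℕ → ℕ) → Σ-list R f (applyUpTo g n) ≡ sum n (λ i → f (g i))
  Σ-list-applyUpTo zero    f g = ≡.refl
  Σ-list-applyUpTo (suc n) f g = ≡.cong (f (g 0) ⊕_) (Σ-list-applyUpTo n f (λ i → g (suc i)))

  sum-cong : ∀ n {f g} → f ≋ g → sum n f ≈ sum n g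
  sum-cong zero    f≋g = refl
  sum-cong (suc n) f≋g = +-cong (f≋g 0) (sum-cong n (λ i → f≋g (suc i)))

  sum-zero : ∀ n {f} → f ≋ (λ _ → 0#) → sum n f ≈ 0#
  sum-zero zero    f≋0 = refl
  sum-zero (suc n) f≋0 = trans (+-cong (f≋0 0) (sum-zero n (λ i → f≋0 (suc i)))) (+-identityˡ 0#)

  sum-linear : ∀ n a f g → sum n (λ i → a ⊗ f i ⊕ g i) ≈ a ⊗ sum n f ⊕ sum n g
  sum-linear zero    a f g = sym (trans (+-congʳ (zeroʳ a)) (+-identityˡ 0#))
  sum-linear (suc n) a f g = begin
    (a ⊗ f 0 ⊕ g 0) ⊕ sum n (λ i → a ⊗ f (suc i) ⊕ g (suc i))
      ≈⟨ +-congˡ (sum-linear n a (tail f) (tail g)) ⟩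
    (a ⊗ f 0 ⊕ g 0) ⊕ (a ⊗ sum n (tail f) ⊕ sum n (tail g))
      ≈⟨ interchange _ _ _ _ ⟩
    (a ⊗ f 0 ⊕ a ⊗ sum n (tail f)) ⊕ (g 0 ⊕ sum n (tail g))
      ≈⟨ +-congʳ (sym (distribˡ a _ _)) ⟩
    a ⊗ sum (suc n) f ⊕ sum (suc n) g ∎
    where open CommutativeSemigroupProperties +-commutativeSemigroup using (interchange)

  infixl 7 _∗_
  _∗_ : Series → Series → Series
  (f ∗ g) n = sum (suc n) (λ a → f a ⊗ g (n ∸ a))

  ∗-cong : ∀ {f f′ g g′} → f ≋ f′ → g ≋ g′ → f ∗ g ≋ f′ ∗ g′
  ∗-cong f≋f′ g≋g′ n = sum-cong (suc n) (λ a → *-cong (f≋f′ a) (g≋g′ (n ∸ a)))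

  ∗-linearˡ : ∀ a f g h → (λ i → a ⊗ f i ⊕ g i) ∗ h ≋ (λ n → a ⊗ (f ∗ h) n ⊕ (g ∗ h) n)
  ∗-linearˡ a f g h n = trans
    (sum-cong (suc n) (λ i → trans (distribʳ (h (n ∸ i)) (a ⊗ f i) (g i)) (+-congʳ (*-assoc a (f i) (h (n ∸ i))))))
    (sum-linear (suc n) a (λ i → f i ⊗ h (n ∸ i)) (λ i → g i ⊗ h (n ∸ i)))

  ∗-suc-last : ∀ f g n → (f ∗ g) (suc n) ≈ (f ∗ tail g) n ⊕ f (suc n) ⊗ g 0
  ∗-suc-last f g zero = begin
    f 0 ⊗ g 1 ⊕ (f 1 ⊗ g 0 ⊕ 0#)  ≈⟨ +-congˡ (+-identityʳ _) ⟩
    f 0 ⊗ g 1 ⊕ f 1 ⊗ g 0         ≈⟨ +-congʳ (sym (+-identityʳ _)) ⟩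
    (f 0 ⊗ g 1 ⊕ 0#) ⊕ f 1 ⊗ g 0  ∎
  ∗-suc-last f g (suc n) = begin
    f 0 ⊗ g (suc (suc n)) ⊕ (tail f ∗ g) (suc n)
      ≈⟨ +-congˡ (∗-suc-last (tail f) g n) ⟩
    f 0 ⊗ g (suc (suc n)) ⊕ ((tail f ∗ tail g) n ⊕ f (suc (suc n)) ⊗ g 0)
      ≈⟨ sym (+-assoc _ _ _) ⟩
    (f ∗ tail g) (suc n) ⊕ f (suc (suc n)) ⊗ g 0 ∎

  ∗-comm : ∀ f g → f ∗ g ≋ g ∗ f
  ∗-comm f g zero    = +-congʳ (*-comm _ _)
  ∗-comm f g (suc n) = begin
    f 0 ⊗ g (suc n) ⊕ (tail f ∗ g) n  ≈⟨ +-cong (*-comm _ _) (∗-comm (tail f) g n) ⟩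
    g (suc n) ⊗ f 0 ⊕ (g ∗ tail f) n  ≈⟨ +-comm _ _ ⟩
    (g ∗ tail f) n ⊕ g (suc n) ⊗ f 0  ≈⟨ sym (∗-suc-last g f n) ⟩
    (g ∗ f) (suc n)                   ∎

  ∗-assoc : ∀ f g h → (f ∗ g) ∗ h ≋ f ∗ (g ∗ h)
  ∗-assoc f g h zero = +-congʳ (begin
    (f 0 ⊗ g 0 ⊕ 0#) ⊗ h 0  ≈⟨ *-congʳ (+-identityʳ _) ⟩
    (f 0 ⊗ g 0) ⊗ h 0       ≈⟨ *-assoc _ _ _ ⟩
    f 0 ⊗ (g 0 ⊗ h 0)       ≈⟨ *-congˡ (sym (+-identityʳ _)) ⟩
    f 0 ⊗ (g 0 ⊗ h 0 ⊕ 0#)  ∎)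
  ∗-assoc f g h (suc n) = begin
    (f ∗ g) 0 ⊗ h (suc n) ⊕ ((λ i → f 0 ⊗ g (suc i) ⊕ (tail f ∗ g) i) ∗ h) n
      ≈⟨ +-cong (trans (*-congʳ (+-identityʳ _)) (*-assoc _ _ _)) (∗-linearˡ (f 0) (tail g) (tail f ∗ g) h n) ⟩
    f 0 ⊗ (g 0 ⊗ h (suc n)) ⊕ (f 0 ⊗ (tail g ∗ h) n ⊕ ((tail f ∗ g) ∗ h) n)
      ≈⟨ +-congˡ (+-congˡ (∗-assoc (tail f) g h n)) ⟩
    f 0 ⊗ (g 0 ⊗ h (suc n)) ⊕ (f 0 ⊗ (tail g ∗ h) n ⊕ (tail f ∗ (g ∗ h)) n)
      ≈⟨ sym (+-assoc _ _ _) ⟩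
    (f 0 ⊗ (g 0 ⊗ h (suc n)) ⊕ f 0 ⊗ (tail g ∗ h) n) ⊕ (tail f ∗ (g ∗ h)) n
      ≈⟨ +-congʳ (sym (distribˡ _ _ _)) ⟩
    (f ∗ (g ∗ h)) (suc n) ∎

  ∗-identityˡ : ∀ g → 𝟙 ∗ g ≋ g
  ∗-identityˡ g n = begin
    1# ⊗ g n ⊕ sum n (λ a → 0# ⊗ g (n ∸ suc a))  ≈⟨ +-cong (*-identityˡ _) (sum-zero n (λ a → zeroˡ _)) ⟩
    g n ⊕ 0#                                     ≈⟨ +-identityʳ _ ⟩
    g n                                          ∎

  ∗-isCommutativeSemigroup : IsCommutativeSemigroup _≋_ _∗_
  ∗-isCommutativeSemigroup = record
    { isSemigroup = record
      { isMagma = record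
        { isEquivalence = record
          { refl = λ n → refl ; sym = λ f≋g n → sym (f≋g n) ; trans = λ f≋g g≋h n → trans (f≋g n) (g≋h n) }
        ; ∙-cong = ∗-cong
        }
      ; assoc = ∗-assoc
      }
    ; comm = ∗-comm
    }

  ∗-commutativeSemigroup : CommutativeSemigroup c ℓ
  ∗-commutativeSemigroup = record { isCommutativeSemigroup = ∗-isCommutativeSemigroup }

  powersWhere : (ℕ → Bool) → Carrier → Series
  powersWhere p x a = if p a then pow R x a else 0#

  powers : Carrier → Series
  powers = powersWhere (λ _ → true)

  restricted : ∀ {n} → (ℕ → Bool) → Vec Carrier n → Series
  restricted p xs k = restrictedSum R p k xs

  restricted-[] : ∀ p → restricted p [] ≋ 𝟙
  restricted-[] p zero    = +-identityʳ 1#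
  restricted-[] p (suc k) = refl

  module _ (p : ℕ → Bool) where

    private
      admissible? : ∀ {n} (a : Vec ℕ n) → Dec (allᵇ p a ≡ true)
      admissible? a = allᵇ p a ≟ true

    filter-map-∷-accept : ∀ {n} a (T : List (Vec ℕ n)) → p a ≡ true →
                          filter admissible? (map (a ∷_) T) ≡ map (a ∷_) (filter admissible? T)
    filter-map-∷-accept a []      pa = ≡.refl
    filter-map-∷-accept a (t ∷ T) pa rewrite pa with allᵇ p t ≟ true
    ... | yes _ = ≡.cong ((a ∷ t) ∷_) (filter-map-∷-accept a T pa)
    ... | no _  = filter-map-∷-accept a T pa

    filter-map-∷-reject : ∀ {n} a (T : List (Vec ℕ n)) → p a ≡ false → filter admissible? (map (a ∷_) T) ≡ []
    filter-map-∷-reject a []      pa = ≡.refl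
    filter-map-∷-reject a (t ∷ T) pa rewrite pa = filter-map-∷-reject a T pa

    Σ-monomial-map-∷ : ∀ {n} x (xs : Vec Carrier n) a T →
                       Σ-list R (monomial R (x ∷ xs)) (map (a ∷_) T) ≈ pow R x a ⊗ Σ-list R (monomial R xs) T
    Σ-monomial-map-∷ x xs a []      = sym (zeroʳ _)
    Σ-monomial-map-∷ x xs a (t ∷ T) = trans (+-congˡ (Σ-monomial-map-∷ x xs a T)) (sym (distribˡ _ _ _))

    Σ-monomial-filter-map-∷ : ∀ {n} x (xs : Vec Carrier n) a T →
      Σ-list R (monomial R (x ∷ xs)) (filter admissible? (map (a ∷_) T))
        ≈ powersWhere p x a ⊗ Σ-list R (monomial R xs) (filter admissible? T)
    Σ-monomial-filter-map-∷ x xs a T with p a in pa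
    ... | true  = trans (reflexive (≡.cong (Σ-list R (monomial R (x ∷ xs))) (filter-map-∷-accept a T pa)))
                        (Σ-monomial-map-∷ x xs a (filter admissible? T))
    ... | false = trans (reflexive (≡.cong (Σ-list R (monomial R (x ∷ xs))) (filter-map-∷-reject a T pa)))
                        (sym (zeroˡ _))

    Σ-monomial-filter-concatMap : ∀ {n} x (xs : Vec Carrier n) (T : ℕ → List (Vec ℕ n)) as →
      Σ-list R (monomial R (x ∷ xs)) (filter admissible? (concatMap (λ a → map (a ∷_) (T a)) as))
        ≈ Σ-list R (λ a → powersWhere p x a ⊗ Σ-list R (monomial R xs) (filter admissible? (T a))) as
    Σ-monomial-filter-concatMap x xs T []       = refl
    Σ-monomial-filter-concatMap {n} x xs T (a ∷ as) = begin
      Σ-list R (monomial R (x ∷ xs)) (filter admissible? (map (a ∷_) (T a) ++ rest))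
        ≈⟨ reflexive (≡.cong (Σ-list R (monomial R (x ∷ xs))) (filter-++ admissible? (map (a ∷_) (T a)) rest)) ⟩
      Σ-list R (monomial R (x ∷ xs)) (filter admissible? (map (a ∷_) (T a)) ++ filter admissible? rest)
        ≈⟨ Σ-list-++ (monomial R (x ∷ xs)) (filter admissible? (map (a ∷_) (T a))) (filter admissible? rest) ⟩
      Σ-list R (monomial R (x ∷ xs)) (filter admissible? (map (a ∷_) (T a)))
        ⊕ Σ-list R (monomial R (x ∷ xs)) (filter admissible? rest)
        ≈⟨ +-cong (Σ-monomial-filter-map-∷ x xs a (T a)) (Σ-monomial-filter-concatMap x xs T as) ⟩
      Σ-list R (λ a → powersWhere p x a ⊗ Σ-list R (monomial R xs) (filter admissible? (T a))) (a ∷ as) ∎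
      where
      rest : List (Vec ℕ (suc n))
      rest = concatMap (λ a → map (a ∷_) (T a)) as

    restricted-∷ : ∀ {n} x (xs : Vec Carrier n) → restricted p (x ∷ xs) ≋ powersWhere p x ∗ restricted p xs
    restricted-∷ {n} x xs k = trans
      (Σ-monomial-filter-concatMap x xs (λ a → tuples n (k ∸ a)) (upTo (suc k)))
      (reflexive (Σ-list-applyUpTo (suc k) (λ a → powersWhere p x a ⊗ restricted p xs (k ∸ a)) (λ i → i)))

  module Dilation (s : ℕ) where

    q : ℕ
    q = suc s

    -- dilateAt j f = t^j · f(t^q)
    dilateAt : ℕ → Series → Series
    dilateAt zero    f zero    = f 0
    dilateAt zero    f (suc n) = dilateAt s (tail f) n
    dilateAt (suc j) f zero    = 0#
    dilateAt (suc j) f (suc n) = dilateAt j f n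

    dilate : Series → Series
    dilate = dilateAt 0

    dilateAt-cong : ∀ j {f g} → f ≋ g → dilateAt j f ≋ dilateAt j g
    dilateAt-cong zero    f≋g zero    = f≋g 0
    dilateAt-cong zero    f≋g (suc n) = dilateAt-cong s (λ i → f≋g (suc i)) n
    dilateAt-cong (suc j) f≋g zero    = refl
    dilateAt-cong (suc j) f≋g (suc n) = dilateAt-cong j f≋g n

    dilateAt-linear : ∀ j a f g → dilateAt j (λ i → a ⊗ f i ⊕ g i) ≋ (λ n → a ⊗ dilateAt j f n ⊕ dilateAt j g n)
    dilateAt-linear zero    a f g zero    = refl
    dilateAt-linear zero    a f g (suc n) = dilateAt-linear s a (tail f) (tail g) n
    dilateAt-linear (suc j) a f g zero    = sym (trans (+-congʳ (zeroʳ a)) (+-identityˡ 0#))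
    dilateAt-linear (suc j) a f g (suc n) = dilateAt-linear j a f g n

    dilateAt-∗ : ∀ j f g → dilateAt j (f ∗ g) ≋ dilateAt j f ∗ dilate g
    dilateAt-∗ zero    f g zero    = refl
    dilateAt-∗ zero    f g (suc n) = begin
      dilateAt s (λ i → f 0 ⊗ g (suc i) ⊕ (tail f ∗ g) i) n
        ≈⟨ dilateAt-linear s (f 0) (tail g) (tail f ∗ g) n ⟩
      f 0 ⊗ dilateAt s (tail g) n ⊕ dilateAt s (tail f ∗ g) n
        ≈⟨ +-congˡ (dilateAt-∗ s (tail f) g n) ⟩
      (dilate f ∗ dilate g) (suc n) ∎
    dilateAt-∗ (suc j) f g zero    = sym (0⊗x⊕y≈y _ 0#)
    dilateAt-∗ (suc j) f g (suc n) = trans (dilateAt-∗ j f g n) (sym (0⊗x⊕y≈y _ _))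

    dilate-∗ : ∀ f g → dilate (f ∗ g) ≋ dilate f ∗ dilate g
    dilate-∗ = dilateAt-∗ 0

    dilateAt-0# : ∀ j n → dilateAt j (λ _ → 0#) n ≡ 0#
    dilateAt-0# zero    zero    = ≡.refl
    dilateAt-0# zero    (suc n) = dilateAt-0# s n
    dilateAt-0# (suc j) zero    = ≡.refl
    dilateAt-0# (suc j) (suc n) = dilateAt-0# j n

    dilate-𝟙 : dilate 𝟙 ≋ 𝟙
    dilate-𝟙 zero    = refl
    dilate-𝟙 (suc n) = reflexive (dilateAt-0# s n)

    dilateAt-below : ∀ {j n} f → n < j → dilateAt j f n ≡ 0#
    dilateAt-below {suc j} {zero}  f _         = ≡.refl
    dilateAt-below {suc j} {suc n} f (s≤s n<j) = dilateAt-below f n<j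

    dilateAt-offset : ∀ j f n → dilateAt j f (j + n) ≡ dilate f n
    dilateAt-offset zero    f n = ≡.refl
    dilateAt-offset (suc j) f n = dilateAt-offset j f n

    dilate-multiple : ∀ f i → dilate f (i * q) ≡ f i
    dilate-multiple f zero    = ≡.refl
    dilate-multiple f (suc i) = ≡.trans (dilateAt-offset s (tail f) (i * q)) (dilate-multiple (tail f) i)

    dilate-nonmultiple : ∀ f i {r} → r < s → dilate f (i * q + suc r) ≡ 0#
    dilate-nonmultiple f zero    r<s = dilateAt-below (tail f) r<s
    dilate-nonmultiple f (suc i) r<s =
      ≡.trans (≡.cong (dilateAt s (tail f)) (ℕ.+-assoc s (i * q) (suc _)))
        (≡.trans (dilateAt-offset s (tail f) (i * q + suc _)) (dilate-nonmultiple (tail f) i r<s))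

    -- landings j n = #{i | j + i q ≤ n}: the steps at which the division loop, started
    -- on suc n with countdown j, increments its quotient.
    landings : ℕ → ℕ → ℕ
    landings j n = div-helper 0 s (suc n) j

    landings-0 : ∀ n → landings 0 n ≡ suc (n / q)
    landings-0 n = divₕ-extractAcc 1 s n s

    sum-dilateAt : ∀ j n f g →
      sum (suc n) (λ a → dilateAt j f a ⊗ g a) ≈ sum (landings j n) (λ i → f i ⊗ g (j + i * q))
    sum-dilateAt zero    zero    f g = refl
    sum-dilateAt (suc j) zero    f g = 0⊗x⊕y≈y _ 0#
    sum-dilateAt (suc j) (suc n) f g = trans (0⊗x⊕y≈y _ _) (sum-dilateAt j n f (tail g))
    sum-dilateAt zero    (suc n) f g = begin
      f 0 ⊗ g 0 ⊕ sum (suc n) (λ a → dilateAt s (tail f) a ⊗ g (suc a))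
        ≈⟨ +-congˡ (sum-dilateAt s n (tail f) (tail g)) ⟩
      f 0 ⊗ g 0 ⊕ sum (landings s n) (λ i → f (suc i) ⊗ g (suc (s + i * q)))
        ≡⟨ ≡.cong (λ m → sum m (λ i → f i ⊗ g (i * q))) (≡.sym (landings-0 (suc n))) ⟩
      sum (landings 0 (suc n)) (λ i → f i ⊗ g (i * q)) ∎

    dilate-∗-coefficient : ∀ f g k → (dilate f ∗ g) k ≈ Σ-upto R (k / q) (λ j → f j ⊗ g (k ∸ q * j))
    dilate-∗-coefficient f g k = begin
      sum (suc k) (λ a → dilate f a ⊗ g (k ∸ a))
        ≈⟨ sum-dilateAt 0 k f (λ a → g (k ∸ a)) ⟩
      sum (landings 0 k) (λ i → f i ⊗ g (k ∸ i * q))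
        ≡⟨ ≡.cong (λ m → sum m (λ i → f i ⊗ g (k ∸ i * q))) (landings-0 k) ⟩
      sum (suc (k / q)) (λ i → f i ⊗ g (k ∸ i * q))
        ≈⟨ sum-cong (suc (k / q)) (λ i → *-congˡ {f i} (reflexive (≡.cong (λ m → g (k ∸ m)) (ℕ.*-comm i q)))) ⟩
      sum (suc (k / q)) (λ j → f j ⊗ g (k ∸ q * j))
        ≡⟨ ≡.sym (Σ-list-applyUpTo (suc (k / q)) (λ j → f j ⊗ g (k ∸ q * j)) (λ i → i)) ⟩
      Σ-upto R (k / q) (λ j → f j ⊗ g (k ∸ q * j)) ∎

    dilate-powers : ∀ x m → dilate (powers (pow R x q)) m ≈ (if m % q ≡ᵇ 0 then pow R x m else 0#)
    dilate-powers x m with m % q | m%n<n m q | m≡m%n+[m/n]*n m q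
    ... | zero  | _       | m≡ = begin
      dilate (powers (pow R x q)) m           ≡⟨ ≡.cong (dilate (powers (pow R x q))) m≡ ⟩
      dilate (powers (pow R x q)) (m / q * q) ≡⟨ dilate-multiple (powers (pow R x q)) (m / q) ⟩
      pow R (pow R x q) (m / q)               ≈⟨ pow-pow x q (m / q) ⟩
      pow R x (m / q * q)                     ≡⟨ ≡.cong (pow R x) (≡.sym m≡) ⟩
      pow R x m                               ∎
    ... | suc r | 1+r<q | m≡ = begin
      dilate (powers (pow R x q)) m
        ≡⟨ ≡.cong (dilate (powers (pow R x q))) (≡.trans m≡ (ℕ.+-comm (suc r) _)) ⟩
      dilate (powers (pow R x q)) (m / q * q + suc r)
        ≡⟨ dilate-nonmultiple (powers (pow R x q)) (m / q) (s≤s⁻¹ 1+r<q) ⟩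
      0# ∎

    zeroOne-∗-suc : ∀ x g a → (powersWhere zeroOne x ∗ g) (suc a) ≈ g (suc a) ⊕ x ⊗ g a
    zeroOne-∗-suc x g a = +-cong (*-identityˡ _)
      (trans (+-cong (*-congʳ (*-identityʳ x)) (sum-zero a (λ b → zeroˡ _))) (+-identityʳ _))

    congOK-suc : 1 ≤ s → ∀ x a {m₀ m₁} → m₁ ≡ suc m₀ ⊎ (m₁ ≡ 0 × m₀ ≡ s) →
      (if (m₁ ≡ᵇ 0) ∨ (m₁ ≡ᵇ 1) then pow R x (suc a) else 0#)
        ≈ (if m₁ ≡ᵇ 0 then pow R x (suc a) else 0#) ⊕ x ⊗ (if m₀ ≡ᵇ 0 then pow R x a else 0#)
    congOK-suc 1≤s x a {zero}  (inj₁ ≡.refl)             = sym (+-identityˡ _)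
    congOK-suc 1≤s x a {suc _} (inj₁ ≡.refl)             = sym (trans (+-identityˡ _) (zeroʳ x))
    congOK-suc 1≤s x a {suc _} (inj₂ (≡.refl , _))       = sym (trans (+-congˡ (zeroʳ x)) (+-identityʳ _))
    congOK-suc ()  x a {zero}  (inj₂ (≡.refl , ≡.refl))

    congOK-powers : 1 ≤ s → ∀ x → powersWhere (congOK s) x ≋ powersWhere zeroOne x ∗ dilate (powers (pow R x q))
    congOK-powers 1≤s x zero    = sym (trans (+-identityʳ _) (*-identityˡ _))
    congOK-powers 1≤s x (suc a) = begin
      powersWhere (congOK s) x (suc a)
        ≈⟨ congOK-suc 1≤s x a (suc-%-cases a q) ⟩
      (if suc a % q ≡ᵇ 0 then pow R x (suc a) else 0#) ⊕ x ⊗ (if a % q ≡ᵇ 0 then pow R x a else 0#)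
        ≈⟨ sym (+-cong (dilate-powers x (suc a)) (*-congˡ (dilate-powers x a))) ⟩
      dilate P (suc a) ⊕ x ⊗ dilate P a
        ≈⟨ sym (zeroOne-∗-suc x (dilate P) a) ⟩
      (powersWhere zeroOne x ∗ dilate P) (suc a) ∎
      where
      P : Series
      P = powers (pow R x q)

    generating-function : 1 ≤ s → ∀ {n} (xs : Vec Carrier n) →
      restricted (congOK s) xs ≋ restricted zeroOne xs ∗ dilate (restricted (λ _ → true) (powVec R q xs))
    generating-function 1≤s [] k = begin
      restricted (congOK s) [] k  ≈⟨ restricted-[] (congOK s) k ⟩
      𝟙 k                         ≈⟨ sym (∗-identityˡ 𝟙 k) ⟩
      (𝟙 ∗ 𝟙) k                   ≈⟨ ∗-cong (λ m → sym (restricted-[] zeroOne m)) unit-dilated k ⟩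
      (restricted zeroOne [] ∗ dilate (restricted (λ _ → true) [])) k ∎
      where
      unit-dilated : 𝟙 ≋ dilate (restricted (λ _ → true) [])
      unit-dilated m = sym (trans (dilateAt-cong 0 (restricted-[] (λ _ → true)) m) (dilate-𝟙 m))
    generating-function 1≤s (x ∷ xs) k = begin
      restricted (congOK s) (x ∷ xs) k
        ≈⟨ restricted-∷ (congOK s) x xs k ⟩
      (powersWhere (congOK s) x ∗ restricted (congOK s) xs) k
        ≈⟨ ∗-cong (congOK-powers 1≤s x) (generating-function 1≤s xs) k ⟩
      ((E₁ ∗ dilate H₁) ∗ (E ∗ dilate H)) k
        ≈⟨ interchange E₁ (dilate H₁) E (dilate H) k ⟩
      ((E₁ ∗ E) ∗ (dilate H₁ ∗ dilate H)) k
        ≈⟨ ∗-cong (λ m → sym (restricted-∷ zeroOne x xs m)) (λ m → sym (dilate-∗ H₁ H m)) k ⟩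
      (restricted zeroOne (x ∷ xs) ∗ dilate (H₁ ∗ H)) k
        ≈⟨ ∗-cong {restricted zeroOne (x ∷ xs)} (λ _ → refl)
                  (dilateAt-cong 0 (λ m → sym (restricted-∷ (λ _ → true) (pow R x q) (powVec R q xs) m))) k ⟩
      (restricted zeroOne (x ∷ xs) ∗ dilate (restricted (λ _ → true) (powVec R q (x ∷ xs)))) k ∎
      where
      open CommutativeSemigroupProperties ∗-commutativeSemigroup using (interchange)
      E₁ H₁ E H : Series
      E₁ = powersWhere zeroOne x
      H₁ = powers (pow R x q)
      E  = restricted zeroOne xs
      H  = restricted (λ _ → true) (powVec R q xs)

theorem5p2 : {c ℓ : Level} (R : CommutativeRing c ℓ) (k n s : ℕ) → 1 ≤ k → 1 ≤ n → 1 ≤ s → (x : Vec (CommutativeRing.Carrier R) n) → CommutativeRing._≈_ R (M R k s x) (Σ-upto R (k / suc s) (λ j → CommutativeRing._*_ R (h R j (powVec R (suc s) x)) (e R (k ∸ suc s * j) x)))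
theorem5p2 R k n s _ _ 1≤s x = begin
  M R k s x                                  ≈⟨ generating-function 1≤s x k ⟩
  (restricted zeroOne x ∗ dilate H) k        ≈⟨ ∗-comm (restricted zeroOne x) (dilate H) k ⟩
  (dilate H ∗ restricted zeroOne x) k        ≈⟨ dilate-∗-coefficient H (restricted zeroOne x) k ⟩
  Σ-upto R (k / suc s) (λ j → H j ⊗ e R (k ∸ suc s * j) x) ∎
  where
  open CommutativeRing R using (setoid) renaming (_*_ to _⊗_)
  open import Relation.Binary.Reasoning.Setoid setoid
  open PowerSeries R
  open Dilation s
  H : Series
  H j = h R j (powVec R (suc s) x)
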